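{- Let $G$ be a deterministic and strongly connected graph. Then $G$ is vertex-transitive if and only if $G$ is circular.
   Context: A graph is a non-empty set $G\subseteq V\times A\times V$ of labelled edges $s\xrightarrow{a}t$ (for some label set $A$); $V_G$ is the set of vertices occurring in edges. An automorphism is a bijection $h:V_G\to V_G$ with $s\xrightarrow{a}t\iff h(s)\xrightarrow{a}h(t)$; $G$ is vertex-transitive if for all $s,t\in V_G$ some automorphism maps $s$ to $t$. $G$ is deterministic if $r\xrightarrow{a}s,\ r\xrightarrow{a}t\Rightarrow s=t$; strongly connected if every vertex reaches every vertex by a directed path. For $u=a_1\cdots a_n$, $s\xrightarrow{u}t$ means there is a path $s=s_0\xrightarrow{a_1}s_1\cdots\xrightarrow{a_n}s_n=t$; $\mathrm{L}_G(s,s)=\{u\mid s\xrightarrow{u}s\}$. $G$ is circular if $\mathrm{L}_G(s,s)=\mathrm{L}_G(t,t)$ for all $s,t\in V_G$. -}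

module Defs where

open import Data.List using (List; []; _∷_)
open import Data.Product using (Σ; ∃; _×_; _,_)
open import Data.Sum using (_⊎_)
open import Function.Definitions using (Bijective)
open import Relation.Binary.PropositionalEquality using (_≡_)

-- Since V_G is the set of vertices occurring in edges, we require every
-- element of V to occur in some edge (so V = V_G), and G non-empty.
record IsGraph {V A : Set} (E : V → A → V → Set) : Set where
  field
    nonEmpty : Σ V λ s → Σ A λ a → Σ V λ t → E s a t
    occurs   : (v : V) → Σ A λ a → Σ V λ w → (E v a w ⊎ E w a v)

data Path {V A : Set} (E : V → A → V → Set) : V → List A → V → Set where
  nil  : ∀ {s} → Path E s [] s
  cons : ∀ {s a r u t} → E s a r → Path E r u t → Path E s (a ∷ u) t

L : {V A : Set} (E : V → A → V → Set) → V → V → List A → Set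
L E s t u = Path E s u t

Deterministic : {V A : Set} → (V → A → V → Set) → Set
Deterministic {V} {A} E = ∀ {r s t : V} {a : A} → E r a s → E r a t → s ≡ t

StronglyConnected : {V A : Set} → (V → A → V → Set) → Set
StronglyConnected {V} {A} E = ∀ (s t : V) → ∃ λ (u : List A) → Path E s u t

IsAutomorphism : {V A : Set} → (V → A → V → Set) → (V → V) → Set
IsAutomorphism {V} {A} E h =
  Bijective _≡_ _≡_ h ×
  (∀ (s : V) (a : A) (t : V) → (E s a t → E (h s) a (h t)) × (E (h s) a (h t) → E s a t))

VertexTransitive : {V A : Set} → (V → A → V → Set) → Set
VertexTransitive {V} E = ∀ (s t : V) → Σ (V → V) λ h → IsAutomorphism E h × h s ≡ t

Circular : {V A : Set} → (V → A → V → Set) → Set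
Circular {V} {A} E = ∀ (s t : V) (u : List A) → (L E s s u → L E t t u) × (L E t t u → L E s s u)

-- If G is circular, fix s and t and send a vertex r to the end of the path
-- from t spelling any word w with s --w--> r.  Such a path exists because w
-- extends to a loop at s, which is then also a loop at t; and its end does
-- not depend on w: if r --v--> s, then v w' is a loop at r, hence at the end
-- y of w read from t, and by determinism y --v--> t --w'--> y.  The map so
-- defined is a homomorphism sending s to t, with the map in the other
-- direction as its inverse.  Conversely an automorphism carrying s to t maps
-- the loops at s onto the loops at t.
module Submission where

open import Defs
open import Data.List using ([]; _∷_; _++_; [_])
open import Data.Product using (∃; _×_; _,_; proj₁; proj₂)
open import Function.Definitions using (StrictlyInverseˡ; StrictlyInverseʳ)
open import Function.Consequences.Propositional
  using (inverseᵇ⇒bijective; strictlyInverseˡ⇒inverseˡ; strictlyInverseʳ⇒inverseʳ)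
open import Relation.Binary.PropositionalEquality
  using (_≡_; refl; subst; subst₂)

module _ {V A : Set} {E : V → A → V → Set} where

  ++-path : ∀ {s m t u v} → Path E s u m → Path E m v t → Path E s (u ++ v) t
  ++-path nil        q = q
  ++-path (cons e p) q = cons e (++-path p q)

  split-path : ∀ u {v s t} → Path E s (u ++ v) t → ∃ λ m → Path E s u m × Path E m v t
  split-path []      p          = _ , nil , p
  split-path (a ∷ u) (cons e p) with split-path u p
  ... | m , p₁ , p₂ = m , cons e p₁ , p₂

  path-deterministic : Deterministic E → ∀ {s u b c} → Path E s u b → Path E s u c → b ≡ c
  path-deterministic det nil        nil         = refl
  path-deterministic det (cons e p) (cons e′ q) with det e e′
  ... | refl = path-deterministic det p q

  extension-edge : Deterministic E → ∀ {s w a x y} →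
                   Path E s w x → Path E s (w ++ [ a ]) y → E x a y
  extension-edge det {w = w} p q with split-path w q
  ... | _ , p′ , cons e nil with path-deterministic det p p′
  ... | refl = e

  Homomorphism : (V → V) → Set
  Homomorphism h = ∀ {s a t} → E s a t → E (h s) a (h t)

  map-path : ∀ {h} → Homomorphism h → ∀ {s u t} → Path E s u t → Path E (h s) u (h t)
  map-path hom nil        = nil
  map-path hom (cons e p) = cons (hom e) (map-path hom p)

  inverse-homomorphisms⇒automorphism : ∀ {h k} → Homomorphism h → Homomorphism k →
    StrictlyInverseˡ _≡_ h k → StrictlyInverseʳ _≡_ h k → IsAutomorphism E h
  inverse-homomorphisms⇒automorphism {h} {k} hom-h hom-k h∘k k∘h =
    inverseᵇ⇒bijective (strictlyInverseˡ⇒inverseˡ h h∘k , strictlyInverseʳ⇒inverseʳ h k∘h) ,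
    λ s a t → hom-h , λ e → subst₂ (λ x y → E x a y) (k∘h s) (k∘h t) (hom-k e)

  vertexTransitive⇒circular : VertexTransitive E → Circular E
  vertexTransitive⇒circular vt s t u = transport s t , transport t s
    where
    transport : ∀ x y → L E x x u → L E y y u
    transport x y with vt x y
    ... | h , (_ , preserves) , refl = map-path (λ {s} {a} {t} → proj₁ (preserves s a t))

  module Transfer (det : Deterministic E) (sc : StronglyConnected E) (circ : Circular E) where

    read-back : ∀ {s w r} → Path E s w r → ∀ t →
                ∃ λ y → Path E t w y × Path E y (proj₁ (sc r s)) t
    read-back {s} {w} {r} p t = split-path w (proj₁ (circ s t _) (++-path p (proj₂ (sc r s))))

    end-unique : ∀ {s t r w w′ y y′} → Path E s w r → Path E s w′ r →
                 Path E t w y → Path E t w′ y′ → y ≡ y′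
    end-unique {s} {t} {r} {w′ = w′} {y} p p′ q q′ with read-back p t
    ... | _ , t→y , y→t with path-deterministic det t→y q
    ... | refl = path-deterministic det loop-at-y (++-path y→t q′)
      where
      loop-at-y : Path E y (proj₁ (sc r s) ++ w′) y
      loop-at-y = proj₁ (circ r y _) (++-path (proj₂ (sc r s)) p′)

    transfer : V → V → V → V
    transfer s t r = proj₁ (read-back (proj₂ (sc s r)) t)

    transfer-path : ∀ {s t w r} → Path E s w r → Path E t w (transfer s t r)
    transfer-path {s} {t} {r = r} p with read-back p t
    ... | y , q , _ = subst (Path E t _) (end-unique p route q (proj₁ (proj₂ (read-back route t)))) q
      where route = proj₂ (sc s r)

    transfer-source : ∀ s t → transfer s t s ≡ t
    transfer-source s t = path-deterministic det (transfer-path nil) nil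

    transfer-transfer : ∀ s t r → transfer t s (transfer s t r) ≡ r
    transfer-transfer s t r =
      path-deterministic det (transfer-path (transfer-path route)) route
      where route = proj₂ (sc s r)

    transfer-homomorphism : ∀ s t → Homomorphism (transfer s t)
    transfer-homomorphism s t {r} e =
      extension-edge det (transfer-path route) (transfer-path (++-path route (cons e nil)))
      where route = proj₂ (sc s r)

    circular⇒vertexTransitive : VertexTransitive E
    circular⇒vertexTransitive s t =
      transfer s t ,
      inverse-homomorphisms⇒automorphism (transfer-homomorphism s t) (transfer-homomorphism t s)
        (transfer-transfer t s) (transfer-transfer s t) ,
      transfer-source s t

lemma4p6 : {V A : Set} (E : V → A → V → Set) → IsGraph E → Deterministic E → StronglyConnected E →
    (VertexTransitive E → Circular E) × (Circular E → VertexTransitive E)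
lemma4p6 E _ det sc =
  vertexTransitive⇒circular , Transfer.circular⇒vertexTransitive det sc
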